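{- Let $k\geq 1$, $n\geq 1$ and $1\leq l\leq k$ be integers, and consider search on paths where the target moves at most $k$ steps after each test. Then $$N_p(n,3k+l)\geq 2nl+4k.$$
   Context: Search model: $G$ is a finite graph on vertex set $\{1,\dots,N\}$ with a loop at every vertex. For $\mathcal A\subseteq\{1,\dots,N\}$, $\Gamma_k(\mathcal A)$ is the set of vertices $j$ such that for some $i\in\mathcal A$ there is a path (walk) from $i$ to $j$ in $G$ of length at most $k$. An unknown target occupies a vertex; a searcher performs tests $\mathcal T_1,\dots,\mathcal T_n\subseteq\{1,\dots,N\}$ one after another; test $i$ returns $y_i=1$ if the target currently lies in $\mathcal T_i$ and $y_i=0$ otherwise; after each test the target moves along a walk of length at most $k$. In an (adaptive) strategy, $\mathcal T_i$ may depend on $y_1,\dots,y_{i-1}$. The sets of possible positions are $\mathcal D_0=\{1,\dots,N\}$ and $\mathcal D_i=\Gamma_k(\mathcal T_i\cap\mathcal D_{i-1})$ if $y_i=1$, $\mathcal D_i=\Gamma_k(\mathcal D_{i-1}\setminus\mathcal T_i)$ if $y_i=0$. A strategy with $n$ tests is $(G,s)$-successful if for every sequence of test results, $|\mathcal D_i|\leq s$ for some $i\in\{0,\dots,n\}$. The path $P_N$ has vertex set $\{1,\dots,N\}$, edges $\{i-1,i\}$ for $2\leq i\leq N$, and a loop at every vertex. $N_p(n,s)$ denotes the maximum $N$ such that a $(P_N,s)$-successful strategy with $n$ tests exists. -}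

module Defs where

open import Data.Nat using (ℕ; zero; suc; _≤_; _+_; _*_)
open import Data.Nat.Properties using (_≟_)
open import Data.Bool using (Bool; true; false; _∧_; _∨_)
open import Data.Fin using (Fin; toℕ)
open import Data.Fin.Subset using (Subset; ⊤; _∩_; _─_; ∣_∣)
open import Data.Vec using (tabulate; lookup)
open import Data.List using (allFin)
open import Data.Bool.ListAction using (any)
open import Data.Product using (_×_)
open import Data.Sum using (_⊎_)
open import Relation.Nullary.Decidable using (⌊_⌋)

-- A finite graph on the vertex set Fin N (vertices 0..N-1 stand for 1..N),
-- given by a Boolean adjacency relation (edge i–j iff adj i j ≡ true).
Graph : ℕ → Set
Graph N = Fin N → Fin N → Bool

pathGraph : (N : ℕ) → Graph N
pathGraph N i j =
  ⌊ toℕ i ≟ toℕ j ⌋ ∨ (⌊ suc (toℕ i) ≟ toℕ j ⌋ ∨ ⌊ suc (toℕ j) ≟ toℕ i ⌋)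

Γ₁ : {N : ℕ} → Graph N → Subset N → Subset N
Γ₁ {N} G A = tabulate (λ j → any (λ i → lookup A i ∧ G i j) (allFin N))

-- Γ_k(A): vertices reachable from A by a walk of length exactly k,
-- which (loops at every vertex) equals "length at most k".
Γ : {N : ℕ} → Graph N → ℕ → Subset N → Subset N
Γ G zero A = A
Γ G (suc k) A = Γ₁ G (Γ G k A)

-- Adaptive strategies with n tests: binary decision trees of depth n.
-- test T s₁ s₀ : perform test T; continue with s₁ if y = 1, with s₀ if y = 0.
data Strategy (N : ℕ) : ℕ → Set where
  done : Strategy N zero
  test : {n : ℕ} → Subset N → Strategy N n → Strategy N n → Strategy N (suc n)

SuccessfulFrom : {N n : ℕ} → Graph N → (k s : ℕ) → Subset N → Strategy N n → Set
SuccessfulFrom G k s D done = ∣ D ∣ ≤ s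
SuccessfulFrom G k s D (test T s₁ s₀) =
  ∣ D ∣ ≤ s ⊎ (SuccessfulFrom G k s (Γ G k (T ∩ D)) s₁ × SuccessfulFrom G k s (Γ G k (D ─ T)) s₀)

Successful : {N n : ℕ} → Graph N → (k s : ℕ) → Strategy N n → Set
Successful G k s σ = SuccessfulFrom G k s ⊤ σ

module Submission where

-- Cut the path after position 2k + nl and first ask whether the target lies to the left.
-- On the left the possible positions then form an initial segment [0, 3k + nl). With j tests
-- left, testing its prefix of length 2k + jl either shrinks the segment by l, or leaves after
-- the move the window [k + jl, 4k + (j+1)l) of size 3k + l. On the right they form a final
-- segment [k + a, N); testing its first k + l positions either leaves a window of size 3k + l
-- or advances the segment by l. Once the tests run out both segments have length at most
-- 3k + l, and N = 2nl + 4k is exactly the length this leaves room for.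

open import Defs
open import Data.Nat using (ℕ; zero; suc; _≤_; _<_; _+_; _*_; _∸_; z≤n; s≤s; _<?_)
open import Data.Nat.Properties
open import Data.Nat.Tactic.RingSolver using (solve-∀)
open import Data.Bool using (true; false; T; _∧_)
open import Data.Bool.Properties using (T-∧)
open import Data.Fin using (Fin; toℕ)
import Data.Fin as Fin
open import Data.Fin.Properties using (toℕ<n)
open import Data.Fin.Subset using (Subset; ⊤; _∩_; _─_; ∣_∣)
open import Data.Vec using ([]; _∷_; tabulate; lookup)
open import Data.Vec.Properties using (lookup∘tabulate; lookup-zipWith)
open import Data.List using (allFin)
open import Data.List.Relation.Unary.Any using (satisfied)
open import Data.List.Relation.Unary.Any.Properties using (any⁻)
open import Data.Product using (Σ; _×_; _,_; proj₁; proj₂)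
open import Data.Sum using (inj₁; inj₂)
open import Function using (_∘_; Equivalence)
open import Relation.Nullary using (¬_; yes; no)
open import Relation.Nullary.Decidable using (⌊_⌋; toWitness; fromWitness)
open import Relation.Binary.PropositionalEquality using (_≡_; sym; trans; cong; subst)

Within : {N : ℕ} → ℕ → ℕ → Subset N → Set
Within {N} a b D = ∀ (i : Fin N) → T (lookup D i) → a ≤ toℕ i × toℕ i < b

module _ {N : ℕ} where

  Within-mono : ∀ {a b a′ b′} (D : Subset N) → a′ ≤ a → b ≤ b′ → Within a b D → Within a′ b′ D
  Within-mono D a′≤a b≤b′ h i i∈D = ≤-trans a′≤a (proj₁ (h i i∈D)) , ≤-trans (proj₂ (h i i∈D)) b≤b′

  Within-< : ∀ {a b} (D : Subset N) → Within a b D → Within a N D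
  Within-< D h i i∈D = proj₁ (h i i∈D) , toℕ<n i

  Within-⊤ : Within 0 N ⊤
  Within-⊤ i _ = z≤n , toℕ<n i

Within-tail : ∀ {N a b} x (D : Subset N) → Within a b (x ∷ D) → Within (a ∸ 1) (b ∸ 1) D
Within-tail x D h i i∈D with h (Fin.suc i) i∈D
... | a≤1+i , s≤s i<b∸1 = ∸-monoˡ-≤ 1 a≤1+i , i<b∸1

Within⇒∣D∣≤b∸a : ∀ {N} a b (D : Subset N) → Within a b D → ∣ D ∣ ≤ b ∸ a
Within⇒∣D∣≤b∸a a b [] h = z≤n
Within⇒∣D∣≤b∸a a b (true ∷ D) h with h Fin.zero _
Within⇒∣D∣≤b∸a .zero (suc b) (true ∷ D) h | z≤n , s≤s _ =
  s≤s (Within⇒∣D∣≤b∸a 0 b D (Within-tail true D h))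
Within⇒∣D∣≤b∸a zero b (false ∷ D) h =
  ≤-trans (Within⇒∣D∣≤b∸a 0 (b ∸ 1) D (Within-tail false D h)) (m∸n≤m b 1)
Within⇒∣D∣≤b∸a (suc a) b (false ∷ D) h =
  ≤-trans (Within⇒∣D∣≤b∸a a (b ∸ 1) D (Within-tail false D h)) (≤-reflexive (∸-+-assoc b 1 a))

Within⇒∣D∣≤ : ∀ {N a b m} (D : Subset N) → Within a b D → b ≤ a + m → ∣ D ∣ ≤ m
Within⇒∣D∣≤ {a = a} {b} D h b≤a+m = ≤-trans (Within⇒∣D∣≤b∸a a b D h) (m≤n+o⇒m∸n≤o b a b≤a+m)

pathGraph-adjacent : ∀ {N} (i j : Fin N) → T (pathGraph N i j) → toℕ j ≤ suc (toℕ i) × toℕ i ≤ suc (toℕ j)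
pathGraph-adjacent i j e with toℕ i ≟ toℕ j | suc (toℕ i) ≟ toℕ j | suc (toℕ j) ≟ toℕ i
... | yes i≡j | _ | _ = m≤n⇒m≤1+n (≤-reflexive (sym i≡j)) , m≤n⇒m≤1+n (≤-reflexive i≡j)
... | no _ | yes 1+i≡j | _ = ≤-reflexive (sym 1+i≡j) , m≤n⇒m≤1+n (≤-trans (n≤1+n _) (≤-reflexive 1+i≡j))
... | no _ | no _ | yes 1+j≡i = m≤n⇒m≤1+n (≤-trans (n≤1+n _) (≤-reflexive 1+j≡i)) , ≤-reflexive (sym 1+j≡i)

Γ₁-member : ∀ {N} (G : Graph N) (D : Subset N) j → T (lookup (Γ₁ G D) j) →
  Σ (Fin N) (λ i → T (lookup D i) × T (G i j))
Γ₁-member {N} G D j j∈ΓD =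
  let i , i∈D∧Gij = satisfied (any⁻ _ (allFin N) (subst T (lookup∘tabulate _ j) j∈ΓD))
  in i , Equivalence.to T-∧ i∈D∧Gij

Γ₁-pathGraph-Within : ∀ {N a b} (D : Subset N) → Within a b D → Within (a ∸ 1) (suc b) (Γ₁ (pathGraph N) D)
Γ₁-pathGraph-Within D h j j∈ΓD with Γ₁-member _ D j j∈ΓD
... | i , i∈D , i~j with h i i∈D | pathGraph-adjacent i j i~j
... | a≤i , i<b | j≤1+i , i≤1+j = ∸-monoˡ-≤ 1 (≤-trans a≤i i≤1+j) , s≤s (≤-trans j≤1+i i<b)

Γ-pathGraph-Within : ∀ {N a b} k (D : Subset N) → Within a b D → Within (a ∸ k) (k + b) (Γ (pathGraph N) k D)
Γ-pathGraph-Within zero D h = h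
Γ-pathGraph-Within {N} {a} (suc k) D h =
  Within-mono (Γ (pathGraph N) (suc k) D) (≤-reflexive a∸[1+k]≡a∸k∸1) ≤-refl
    (Γ₁-pathGraph-Within (Γ (pathGraph N) k D) (Γ-pathGraph-Within k D h))
  where
  a∸[1+k]≡a∸k∸1 : a ∸ suc k ≡ a ∸ k ∸ 1
  a∸[1+k]≡a∸k∸1 = sym (trans (∸-+-assoc a k 1) (cong (a ∸_) (+-comm k 1)))

Γ-pathGraph-Within-shift : ∀ {N a b} k (D : Subset N) → Within (k + a) b D → Within a (k + b) (Γ (pathGraph N) k D)
Γ-pathGraph-Within-shift {N} {a} k D h =
  Within-mono (Γ (pathGraph N) k D) (≤-reflexive (sym (m+n∸m≡n k a))) ≤-refl (Γ-pathGraph-Within k D h)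

prefix : ∀ {N} → ℕ → Subset N
prefix c = tabulate (λ i → ⌊ toℕ i <? c ⌋)

module _ {N : ℕ} (c : ℕ) (i : Fin N) where

  ∈prefix⇒< : T (lookup (prefix c) i) → toℕ i < c
  ∈prefix⇒< = toWitness ∘ subst T (lookup∘tabulate _ i)

  ∉prefix⇒≥ : ¬ T (lookup (prefix c) i) → c ≤ toℕ i
  ∉prefix⇒≥ i∉P = ≮⇒≥ (i∉P ∘ subst T (sym (lookup∘tabulate _ i)) ∘ fromWitness)

∩-member : ∀ {N} (P D : Subset N) i → T (lookup (P ∩ D) i) → T (lookup P i) × T (lookup D i)
∩-member P D i = Equivalence.to T-∧ ∘ subst T (lookup-zipWith _∧_ i P D)

─-member : ∀ {N} (D P : Subset N) i → T (lookup (D ─ P) i) → T (lookup D i) × ¬ T (lookup P i)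
─-member (x ∷ D) (true ∷ P) Fin.zero ()
─-member (x ∷ D) (false ∷ P) Fin.zero x∈D = x∈D , λ ()
─-member (x ∷ D) (y ∷ P) (Fin.suc i) = ─-member D P i

prefix∩-Within : ∀ {N a b} c (D : Subset N) → Within a b D → Within a c (prefix c ∩ D)
prefix∩-Within c D h i i∈ =
  let i∈P , i∈D = ∩-member (prefix c) D i i∈ in proj₁ (h i i∈D) , ∈prefix⇒< c i i∈P

─prefix-Within : ∀ {N a b} c (D : Subset N) → Within a b D → Within c b (D ─ prefix c)
─prefix-Within c D h i i∈ =
  let i∈D , i∉P = ─-member D (prefix c) i i∈ in ∉prefix⇒≥ c i i∉P , proj₂ (h i i∈D)

SuccessfulFrom-small : ∀ {N n} (G : Graph N) k s (D : Subset N) (σ : Strategy N n) →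
  ∣ D ∣ ≤ s → SuccessfulFrom G k s D σ
SuccessfulFrom-small G k s D done small = small
SuccessfulFrom-small G k s D (test P σ₁ σ₀) small = inj₁ small

cut-moved-left : ∀ k l j → k + (k + (k + suc j * l)) ≡ j * l + (3 * k + l)
cut-moved-left = solve-∀

cut-moved-right : ∀ k l a → k + (k + (k + (a + l))) ≡ a + (3 * k + l)
cut-moved-right = solve-∀

right-window-step : ∀ k l a j → k + a + (suc j * l + (3 * k + l)) ≡ k + (a + l) + (j * l + (3 * k + l))
right-window-step = solve-∀

path-length : ∀ k l n → 2 * suc n * l + 4 * k ≡ k + suc n * l + (n * l + (3 * k + l))
path-length = solve-∀

module PathSearch (N k l : ℕ) where

  G : Graph N
  G = pathGraph N

  s : ℕ
  s = 3 * k + l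

  leftCut : ℕ → ℕ
  leftCut j = k + (k + suc j * l)

  rightCut : ℕ → ℕ
  rightCut a = k + (k + (a + l))

  left : (j : ℕ) → Strategy N j
  left zero = done
  left (suc j) = test (prefix (leftCut j)) (left j) (left j)

  right : (j a : ℕ) → Strategy N j
  right zero a = done
  right (suc j) a = test (prefix (rightCut a)) (right j a) (right j (a + l))

  left-successful : ∀ j b (D : Subset N) → Within 0 b D → b ≤ j * l + s → SuccessfulFrom G k s D (left j)
  left-after-cut : ∀ j (D : Subset N) → Within 0 (leftCut j) D → SuccessfulFrom G k s (Γ G k D) (left j)

  left-successful zero b D h b≤s = Within⇒∣D∣≤ D h b≤s
  left-successful (suc j) b D h b≤ = inj₂ (left-after-cut j (prefix c ∩ D) (prefix∩-Within c D h) , rest)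
    where
    c : ℕ
    c = leftCut j
    rest : SuccessfulFrom G k s (Γ G k (D ─ prefix c)) (left j)
    rest = SuccessfulFrom-small G k s _ (left j)
      (Within⇒∣D∣≤ (Γ G k (D ─ prefix c)) (Γ-pathGraph-Within-shift k _ (─prefix-Within c D h))
        (≤-trans (+-monoʳ-≤ k b≤) (≤-reflexive (sym (+-assoc k (suc j * l) s)))))

  left-after-cut j D h =
    left-successful j (k + leftCut j) (Γ G k D)
      (Within-mono (Γ G k D) z≤n ≤-refl (Γ-pathGraph-Within k D h)) (≤-reflexive (cut-moved-left k l j))

  right-successful : ∀ j a (D : Subset N) → Within (k + a) N D → N ≤ k + a + (j * l + s) →
    SuccessfulFrom G k s D (right j a)
  right-after-cut : ∀ j a (D : Subset N) → Within (k + (k + a)) N D → N ≤ k + a + (j * l + s) →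
    SuccessfulFrom G k s (Γ G k D) (right j a)

  right-successful zero a D h N≤ = Within⇒∣D∣≤ D h N≤
  right-successful (suc j) a D h N≤ =
    inj₂ (isolated , right-after-cut j (a + l) (D ─ prefix c) (─prefix-Within c D h)
                       (≤-trans N≤ (≤-reflexive (right-window-step k l a j))))
    where
    c : ℕ
    c = rightCut a
    isolated : SuccessfulFrom G k s (Γ G k (prefix c ∩ D)) (right j a)
    isolated = SuccessfulFrom-small G k s _ (right j a)
      (Within⇒∣D∣≤ (Γ G k (prefix c ∩ D)) (Γ-pathGraph-Within-shift k _ (prefix∩-Within c D h))
        (≤-reflexive (cut-moved-right k l a)))

  right-after-cut j a D h =
    right-successful j a (Γ G k D) (Within-< (Γ G k D) (Γ-pathGraph-Within-shift k D h))

  search : (n : ℕ) → Strategy N (suc n)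
  search n = test (prefix (leftCut n)) (left n) (right n (suc n * l))

  search-successful : ∀ n → N ≤ k + suc n * l + (n * l + s) → Successful G k s (search n)
  search-successful n N≤ =
    inj₂ ( left-after-cut n (prefix c ∩ ⊤) (prefix∩-Within c ⊤ Within-⊤)
         , right-after-cut n (suc n * l) (⊤ ─ prefix c) (─prefix-Within c ⊤ Within-⊤) N≤)
    where
    c : ℕ
    c = leftCut n

-- The construction needs only n ≥ 1.
theorem3 : (k n l : ℕ) → 1 ≤ k → 1 ≤ n → 1 ≤ l → l ≤ k →
    Σ ℕ (λ N → (2 * n * l + 4 * k ≤ N) × Σ (Strategy N n) (λ σ → Successful (pathGraph N) k (3 * k + l) σ))
theorem3 k zero l _ () _ _
theorem3 k (suc n) l _ _ _ _ =
  N , ≤-refl , search n , search-successful n (≤-reflexive (path-length k l n))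
  where
  N : ℕ
  N = 2 * suc n * l + 4 * k
  open PathSearch N k l
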